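{- For all integers $m\geq 1$ and $n\geq 0$, \[ \sum_{k=0}^{n}\binom{n}{k}\frac{m^{k}B_{k+1}B_{n-k}}{k+1}=\frac{ -mB_{n}-B_{n+1}}{m}+m^{n-1}\sum_{k=0}^{m-1}\frac{k}{m}\,B_{n}\!\left(\frac{k}{m}\right). \]
   Context: The Bernoulli polynomials are defined by $\sum_{n\ge0}B_n(x)\frac{t^n}{n!}=\frac{te^{xt}}{e^t-1}$ and the Bernoulli numbers by $B_n=B_n(0)$ (so $B_1=-1/2$). -}

module Defs where

open import Data.Nat as ℕ using (ℕ; zero; suc)
open import Data.Nat.Combinatorics using (_C_)
open import Data.Integer using (+_)
open import Data.Rational using (ℚ; 0ℚ; 1ℚ; _+_; _*_; -_; _/_)
open import Data.List using (List; []; _∷_; _++_; [_])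

sumBelow : ℕ → (ℕ → ℚ) → ℚ
sumBelow zero    f = 0ℚ
sumBelow (suc n) f = sumBelow n f + f n

ℕ→ℚ : ℕ → ℚ
ℕ→ℚ n = (+ n) / 1

_^ℚ_ : ℚ → ℕ → ℚ
x ^ℚ zero  = 1ℚ
x ^ℚ suc n = x * (x ^ℚ n)

nth : List ℚ → ℕ → ℚ
nth []       _       = 0ℚ
nth (x ∷ xs) zero    = x
nth (x ∷ xs) (suc k) = nth xs k

-- bernTable n = [B_0, ..., B_n], computed by the standard recurrence
-- B_0 = 1,  Σ_{k=0}^{N} C(N+1,k) B_k = 0  (N ≥ 1),  i.e.
-- B_{n+1} = -(1/(n+2)) Σ_{k=0}^{n} C(n+2,k) B_k ;  this gives B_1 = -1/2.
bernTable : ℕ → List ℚ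
bernTable zero    = [ 1ℚ ]
bernTable (suc n) =
  bernTable n ++
  [ - (((+ 1) / suc (suc n)) *
       sumBelow (suc n) (λ k → ℕ→ℚ (suc (suc n) C k) * nth (bernTable n) k)) ]

bernoulli : ℕ → ℚ
bernoulli n = nth (bernTable n) n

bernoulliPoly : ℕ → ℚ → ℚ
bernoulliPoly n x =
  sumBelow (suc n) (λ k → ℕ→ℚ (n C k) * bernoulli k * (x ^ℚ (n ℕ.∸ k)))

-- Write P_q(m) = Σ_{k<m} k^q. Expanding B_n(k/m) by its definition turns the second term on
-- the right into Σ_j C(n,j) B_j m^{j-2} P_{n+1-j}(m), and Faulhaber's formula
-- (q+1) P_q(m) = Σ_{i≤q} C(q+1,i) B_i m^{q+1-i}, the telescoped form of
-- B_{q+1}(x+1) - B_{q+1}(x) = (q+1) x^q, makes it a double sum over pairs (j, i). The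
-- coefficient of B_i m^{n-i} is Σ_j κ_{j,i} B_j with, for e = n - i,
--   κ_{j,i} = C(n,j) C(n+2-j,i)/(n+2-j) = C(n,i) C(e+2,j) (n+1-j)/((e+2)(e+1)).
-- As Σ_{j≤e+1} C(e+2,j) B_j = 0 and Σ_{j≤e+1} C(e+1,j) B_j = B_{e+1} + [e = 0], this is
-- C(n,i) (B_{e+1} + [e = 0])/(e+1) for i ≤ n, and 1 for i = n+1. So the second term on the
-- right is the left-hand side plus B_n + B_{n+1}/m, which the first term cancels.

module Submission where

open import Defs
open import Data.Nat as ℕ using (ℕ; zero; suc; NonZero; _∸_; _≤_; _<_; s≤s; z≤n; _!)
import Data.Nat.Properties as ℕₚ
open import Data.Nat.Properties using (_!≢0; _!*_!≢0)
open import Data.Nat.Combinatorics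
  using (_C_; nCk+nC[k+1]≡[n+1]C[k+1]; k>n⇒nCk≡0; nCn≡1; nC1≡n; nCk≡nC[n∸k]; nCk≡n!/k![n-k]!; k![n∸k]!∣n!)
open import Data.Nat.DivMod using (m/n*n≡m)
import Data.Nat.Tactic.RingSolver as ℕ-Solver
open import Relation.Nullary using (yes; no)
open import Data.Integer using (+_)
import Data.Integer.Properties as ℤₚ
open import Data.Rational using (ℚ; mkℚ; 0ℚ; 1ℚ; _+_; _*_; _-_; -_; _/_; _≟_)
open import Data.Rational.Properties
import Data.Rational.Unnormalised as ℚᵘ
open import Data.Nat.Coprimality using (1-coprimeTo)
import Data.Nat.Coprimality as Coprime
open import Relation.Nullary.Decidable using (dec⇒maybe)
open import Data.List using ([]; _∷_; _++_; [_]; length)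
open import Data.List.Properties using (length-++)
open import Data.Sum using (inj₁; inj₂)
open import Function using (_∘_)
open import Relation.Binary.PropositionalEquality hiding ([_])
open import Tactic.RingSolver using (solve-∀)
open import Tactic.RingSolver.Core.AlmostCommutativeRing using (AlmostCommutativeRing; fromCommutativeRing)
open import Algebra.Bundles using (CommutativeMonoid)
open import Algebra.Properties.CommutativeSemigroup
  (CommutativeMonoid.commutativeSemigroup +-0-commutativeMonoid) using () renaming (interchange to +-interchange)
open import Algebra.Properties.CommutativeSemigroup
  (CommutativeMonoid.commutativeSemigroup *-1-commutativeMonoid) using () renaming (interchange to *-interchange)

open ≡-Reasoning

ℚ-ring : AlmostCommutativeRing _ _
ℚ-ring = fromCommutativeRing +-*-commutativeRing (dec⇒maybe ∘ (0ℚ ≟_))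

-- Finite sums

sumBelow-cong : ∀ n {f g : ℕ → ℚ} → (∀ {k} → k < n → f k ≡ g k) → sumBelow n f ≡ sumBelow n g
sumBelow-cong zero    f≗g = refl
sumBelow-cong (suc n) f≗g = cong₂ _+_ (sumBelow-cong n (f≗g ∘ ℕₚ.m<n⇒m<1+n)) (f≗g (ℕₚ.n<1+n n))

sumBelow-0 : ∀ n → sumBelow n (λ _ → 0ℚ) ≡ 0ℚ
sumBelow-0 zero    = refl
sumBelow-0 (suc n) = trans (+-identityʳ _) (sumBelow-0 n)

sumBelow-+ : ∀ n (f g : ℕ → ℚ) → sumBelow n (λ k → f k + g k) ≡ sumBelow n f + sumBelow n g
sumBelow-+ zero    f g = sym (+-identityʳ 0ℚ)
sumBelow-+ (suc n) f g = trans (cong (_+ (f n + g n)) (sumBelow-+ n f g))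
                               (+-interchange (sumBelow n f) (sumBelow n g) (f n) (g n))

sumBelow-*ˡ : ∀ n c (f : ℕ → ℚ) → c * sumBelow n f ≡ sumBelow n (λ k → c * f k)
sumBelow-*ˡ zero    c f = *-zeroʳ c
sumBelow-*ˡ (suc n) c f = trans (*-distribˡ-+ c _ _) (cong (_+ c * f n) (sumBelow-*ˡ n c f))

sumBelow-*ʳ : ∀ n c (f : ℕ → ℚ) → sumBelow n f * c ≡ sumBelow n (λ k → f k * c)
sumBelow-*ʳ n c f = trans (*-comm (sumBelow n f) c)
  (trans (sumBelow-*ˡ n c f) (sumBelow-cong n (λ {k} _ → *-comm c (f k))))

sumBelow-suc : ∀ n (f : ℕ → ℚ) → sumBelow (suc n) f ≡ f 0 + sumBelow n (f ∘ suc)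
sumBelow-suc zero    f = trans (+-identityˡ (f 0)) (sym (+-identityʳ (f 0)))
sumBelow-suc (suc n) f = trans (cong (_+ f (suc n)) (sumBelow-suc n f)) (+-assoc (f 0) _ _)

sumBelow-swap : ∀ a b (f : ℕ → ℕ → ℚ) →
  sumBelow a (λ i → sumBelow b (f i)) ≡ sumBelow b (λ j → sumBelow a (λ i → f i j))
sumBelow-swap zero    b f = sym (sumBelow-0 b)
sumBelow-swap (suc a) b f = trans (cong (_+ sumBelow b (f a)) (sumBelow-swap a b f))
                                  (sym (sumBelow-+ b _ (f a)))

sumBelow-reverse : ∀ n (f : ℕ → ℚ) → sumBelow (suc n) f ≡ sumBelow (suc n) (λ k → f (n ∸ k))
sumBelow-reverse zero    f = refl
sumBelow-reverse (suc n) f = begin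
  sumBelow (suc (suc n)) f
    ≡⟨ sumBelow-suc (suc n) f ⟩
  f 0 + sumBelow (suc n) (f ∘ suc)
    ≡⟨ cong (_+_ (f 0)) (sumBelow-reverse n (f ∘ suc)) ⟩
  f 0 + sumBelow (suc n) (λ k → f (suc (n ∸ k)))
    ≡⟨ +-comm (f 0) _ ⟩
  sumBelow (suc n) (λ k → f (suc (n ∸ k))) + f 0
    ≡⟨ cong₂ _+_ (sumBelow-cong (suc n) (cong f ∘ sym ∘ ℕₚ.+-∸-assoc 1 ∘ ℕₚ.≤-pred))
                 (cong f (sym (ℕₚ.n∸n≡0 n))) ⟩
  sumBelow (suc (suc n)) (λ k → f (suc n ∸ k))  ∎

sumBelow-triangle-suc : ∀ N (f : ℕ → ℕ → ℚ) →
  sumBelow (suc N) (λ j → sumBelow (suc N ∸ j) (f j)) ≡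
  sumBelow N (λ j → sumBelow (N ∸ j) (f j)) + sumBelow (suc N) (λ j → f j (N ∸ j))
sumBelow-triangle-suc N f = begin
  sumBelow (suc N) (λ j → sumBelow (suc N ∸ j) (f j))
    ≡⟨ sumBelow-cong (suc N) (λ {j} → cong (λ l → sumBelow l (f j)) ∘ ℕₚ.+-∸-assoc 1 ∘ ℕₚ.≤-pred) ⟩
  sumBelow (suc N) (λ j → sumBelow (N ∸ j) (f j) + f j (N ∸ j))
    ≡⟨ sumBelow-+ (suc N) _ _ ⟩
  triangle + sumBelow (N ∸ N) (f N) + diagonal
    ≡⟨ cong (λ l → triangle + sumBelow l (f N) + diagonal) (ℕₚ.n∸n≡0 N) ⟩
  triangle + 0ℚ + diagonal
    ≡⟨ cong (_+ diagonal) (+-identityʳ triangle) ⟩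
  triangle + diagonal  ∎
  where
  triangle = sumBelow N (λ j → sumBelow (N ∸ j) (f j))
  diagonal = sumBelow (suc N) (λ j → f j (N ∸ j))

sumBelow-triangle : ∀ N (f : ℕ → ℕ → ℚ) →
  sumBelow N (λ j → sumBelow (N ∸ j) (f j)) ≡ sumBelow N (λ r → sumBelow (N ∸ r) (λ j → f j r))
sumBelow-triangle zero    f = refl
sumBelow-triangle (suc N) f = begin
  sumBelow (suc N) (λ j → sumBelow (suc N ∸ j) (f j))
    ≡⟨ sumBelow-triangle-suc N f ⟩
  sumBelow N (λ j → sumBelow (N ∸ j) (f j)) + sumBelow (suc N) (λ j → f j (N ∸ j))
    ≡⟨ cong₂ _+_ (sumBelow-triangle N f) antidiagonal-flip ⟩
  sumBelow N (λ r → sumBelow (N ∸ r) (λ j → f j r)) + sumBelow (suc N) (λ r → f (N ∸ r) r)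
    ≡⟨ sumBelow-triangle-suc N (λ r j → f j r) ⟨
  sumBelow (suc N) (λ r → sumBelow (suc N ∸ r) (λ j → f j r))  ∎
  where
  antidiagonal-flip : sumBelow (suc N) (λ j → f j (N ∸ j)) ≡ sumBelow (suc N) (λ r → f (N ∸ r) r)
  antidiagonal-flip = trans (sumBelow-reverse N _)
    (sumBelow-cong (suc N) (cong (f _) ∘ ℕₚ.m∸[m∸n]≡n ∘ ℕₚ.≤-pred))

-- Natural numbers, inverses and powers in ℚ

ℕ→ℚ≡mkℚ : ∀ a → ℕ→ℚ a ≡ mkℚ (+ a) 0 (Coprime.sym (1-coprimeTo a))
ℕ→ℚ≡mkℚ a = normalize-coprime (Coprime.sym (1-coprimeTo a))

ℕ→ℚ-+ : ∀ a b → ℕ→ℚ (a ℕ.+ b) ≡ ℕ→ℚ a + ℕ→ℚ b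
ℕ→ℚ-+ a b rewrite ℕ→ℚ≡mkℚ a | ℕ→ℚ≡mkℚ b =
  /-cong (sym (cong₂ Data.Integer._+_ (ℤₚ.*-identityʳ (+ a)) (ℤₚ.*-identityʳ (+ b)))) refl

ℕ→ℚ-* : ∀ a b → ℕ→ℚ (a ℕ.* b) ≡ ℕ→ℚ a * ℕ→ℚ b
ℕ→ℚ-* a b rewrite ℕ→ℚ≡mkℚ a | ℕ→ℚ≡mkℚ b = /-cong (ℤₚ.pos-* a b) refl

ℕ→ℚ-^ : ∀ a b → ℕ→ℚ (a ℕ.^ b) ≡ ℕ→ℚ a ^ℚ b
ℕ→ℚ-^ a zero    = refl
ℕ→ℚ-^ a (suc b) = trans (ℕ→ℚ-* a (a ℕ.^ b)) (cong (ℕ→ℚ a *_) (ℕ→ℚ-^ a b))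

1/ℕ_ : (d : ℕ) → .{{NonZero d}} → ℚ
1/ℕ d = + 1 / d

+a/d≡a*1/ℕd : ∀ a d .{{_ : NonZero d}} → + a / d ≡ ℕ→ℚ a * 1/ℕ d
+a/d≡a*1/ℕd a d@(suc d-1) rewrite ℕ→ℚ≡mkℚ a | normalize-coprime (1-coprimeTo d) =
  /-cong (sym (ℤₚ.*-identityʳ (+ a))) (cong suc (sym (ℕₚ.+-identityʳ d-1)))

ℕ→ℚ-*-1/ℕ : ∀ d .{{_ : NonZero d}} → ℕ→ℚ d * 1/ℕ d ≡ 1ℚ
ℕ→ℚ-*-1/ℕ d@(suc d-1) = trans (sym (+a/d≡a*1/ℕd d d))
  (fromℚᵘ-cong {ℚᵘ.mkℚᵘ (+ d) d-1} {ℚᵘ.1ℚᵘ} (ℚᵘ.*≡* (ℤₚ.*-comm (+ d) (+ 1))))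

ℕ→ℚ*a≡b⇒a≡1/ℕ*b : ∀ d .{{_ : NonZero d}} {a b} → ℕ→ℚ d * a ≡ b → a ≡ 1/ℕ d * b
ℕ→ℚ*a≡b⇒a≡1/ℕ*b d {a} {b} da≡b = begin
  a                        ≡⟨ *-identityˡ a ⟨
  1ℚ * a                   ≡⟨ cong (_* a) (trans (*-comm (1/ℕ d) (ℕ→ℚ d)) (ℕ→ℚ-*-1/ℕ d)) ⟨
  1/ℕ d * ℕ→ℚ d * a        ≡⟨ *-assoc (1/ℕ d) (ℕ→ℚ d) a ⟩
  1/ℕ d * (ℕ→ℚ d * a)      ≡⟨ cong (1/ℕ d *_) da≡b ⟩
  1/ℕ d * b                ∎

a*p≡b*q⇒a*q′≡b*p′ : ∀ {a b p p′ q q′} →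
  p * p′ ≡ 1ℚ → q * q′ ≡ 1ℚ → a * p ≡ b * q → a * q′ ≡ b * p′
a*p≡b*q⇒a*q′≡b*p′ {a} {b} {p} {p′} {q} {q′} pp′≡1 qq′≡1 ap≡bq = begin
  a * q′                ≡⟨ *-identityʳ (a * q′) ⟨
  a * q′ * 1ℚ           ≡⟨ cong (a * q′ *_) pp′≡1 ⟨
  a * q′ * (p * p′)     ≡⟨ regroup a q′ p p′ ⟩
  a * p * (q′ * p′)     ≡⟨ cong (_* (q′ * p′)) ap≡bq ⟩
  b * q * (q′ * p′)     ≡⟨ regroup′ b q q′ p′ ⟩
  b * p′ * (q * q′)     ≡⟨ cong (b * p′ *_) qq′≡1 ⟩
  b * p′ * 1ℚ           ≡⟨ *-identityʳ (b * p′) ⟩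
  b * p′                ∎
  where
  regroup : ∀ w x y z → w * x * (y * z) ≡ w * y * (x * z)
  regroup = solve-∀ ℚ-ring
  regroup′ : ∀ w x y z → w * x * (y * z) ≡ w * z * (x * y)
  regroup′ = solve-∀ ℚ-ring

^ℚ-+ : ∀ x a b → x ^ℚ (a ℕ.+ b) ≡ x ^ℚ a * x ^ℚ b
^ℚ-+ x zero    b = sym (*-identityˡ (x ^ℚ b))
^ℚ-+ x (suc a) b = trans (cong (x *_) (^ℚ-+ x a b)) (sym (*-assoc x (x ^ℚ a) (x ^ℚ b)))

^ℚ-distrib-* : ∀ x y a → (x * y) ^ℚ a ≡ x ^ℚ a * y ^ℚ a
^ℚ-distrib-* x y zero    = refl
^ℚ-distrib-* x y (suc a) =
  trans (cong ((x * y) *_) (^ℚ-distrib-* x y a)) (*-interchange x y (x ^ℚ a) (y ^ℚ a))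

1^ℚ : ∀ a → 1ℚ ^ℚ a ≡ 1ℚ
1^ℚ zero    = refl
1^ℚ (suc a) = trans (*-identityˡ (1ℚ ^ℚ a)) (1^ℚ a)

^ℚ-cancel : ∀ {x y} → x * y ≡ 1ℚ → ∀ a b → x ^ℚ (a ℕ.+ b) * y ^ℚ b ≡ x ^ℚ a
^ℚ-cancel {x} {y} xy≡1 a b = begin
  x ^ℚ (a ℕ.+ b) * y ^ℚ b       ≡⟨ cong (_* y ^ℚ b) (^ℚ-+ x a b) ⟩
  x ^ℚ a * x ^ℚ b * y ^ℚ b      ≡⟨ *-assoc (x ^ℚ a) _ _ ⟩
  x ^ℚ a * (x ^ℚ b * y ^ℚ b)    ≡⟨ cong (x ^ℚ a *_) (^ℚ-distrib-* x y b) ⟨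
  x ^ℚ a * (x * y) ^ℚ b         ≡⟨ cong (λ z → x ^ℚ a * z ^ℚ b) xy≡1 ⟩
  x ^ℚ a * 1ℚ ^ℚ b              ≡⟨ cong (x ^ℚ a *_) (1^ℚ b) ⟩
  x ^ℚ a * 1ℚ                   ≡⟨ *-identityʳ (x ^ℚ a) ⟩
  x ^ℚ a                        ∎

-- Binomial coefficients

nCk*k!*[n∸k]!≡n! : ∀ {n k} → k ≤ n → (n C k) ℕ.* (k ! ℕ.* (n ∸ k) !) ≡ n !
nCk*k!*[n∸k]!≡n! {n} {k} k≤n =
  trans (cong (ℕ._* (k ! ℕ.* (n ∸ k) !)) (nCk≡n!/k![n-k]! k≤n))
        (m/n*n≡m {{k !* (n ∸ k) !≢0}} (k![n∸k]!∣n! k≤n))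

[1+n]Cn≡1+n : ∀ n → suc n C n ≡ suc n
[1+n]Cn≡1+n n = begin
  suc n C n            ≡⟨ nCk≡nC[n∸k] (ℕₚ.n≤1+n n) ⟩
  suc n C (suc n ∸ n)  ≡⟨ cong (suc n C_) (ℕₚ.m+n∸n≡m 1 n) ⟩
  suc n C 1            ≡⟨ nC1≡n (suc n) ⟩
  suc n                ∎

nCj*[n∸j]Cr≡nCr*[n∸r]Cj : ∀ {n j r} → j ℕ.+ r ≤ n →
  (n C j) ℕ.* ((n ∸ j) C r) ≡ (n C r) ℕ.* ((n ∸ r) C j)
nCj*[n∸j]Cr≡nCr*[n∸r]Cj {n} {j} {r} j+r≤n =
  ℕₚ.*-cancelʳ-≡ _ _ (j ! ℕ.* (r ! ℕ.* (n ∸ j ∸ r) !)) {{nonZero}} (begin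
    (n C j) ℕ.* ((n ∸ j) C r) ℕ.* (j ! ℕ.* (r ! ℕ.* (n ∸ j ∸ r) !))
      ≡⟨ choose-twice j r j+r≤n ⟩
    n !
      ≡⟨ choose-twice r j (subst (_≤ n) (ℕₚ.+-comm j r) j+r≤n) ⟨
    (n C r) ℕ.* ((n ∸ r) C j) ℕ.* (r ! ℕ.* (j ! ℕ.* (n ∸ r ∸ j) !))
      ≡⟨ cong ((n C r) ℕ.* ((n ∸ r) C j) ℕ.*_) swap-factorials ⟩
    (n C r) ℕ.* ((n ∸ r) C j) ℕ.* (j ! ℕ.* (r ! ℕ.* (n ∸ j ∸ r) !))  ∎)
  where
  nonZero = ℕₚ.m*n≢0 (j !) _ {{j !≢0}} {{r !* (n ∸ j ∸ r) !≢0}}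
  choose-twice : ∀ a b → a ℕ.+ b ≤ n →
    (n C a) ℕ.* ((n ∸ a) C b) ℕ.* (a ! ℕ.* (b ! ℕ.* (n ∸ a ∸ b) !)) ≡ n !
  choose-twice a b a+b≤n = begin
    (n C a) ℕ.* ((n ∸ a) C b) ℕ.* (a ! ℕ.* (b ! ℕ.* (n ∸ a ∸ b) !))
      ≡⟨ regroup (n C a) ((n ∸ a) C b) (a !) _ ⟩
    (n C a) ℕ.* (a ! ℕ.* (((n ∸ a) C b) ℕ.* (b ! ℕ.* (n ∸ a ∸ b) !)))
      ≡⟨ cong (λ x → (n C a) ℕ.* (a ! ℕ.* x)) (nCk*k!*[n∸k]!≡n! b≤n∸a) ⟩
    (n C a) ℕ.* (a ! ℕ.* (n ∸ a) !)
      ≡⟨ nCk*k!*[n∸k]!≡n! (ℕₚ.m+n≤o⇒m≤o a a+b≤n) ⟩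
    n !  ∎
    where
    b≤n∸a = ℕₚ.m+n≤o⇒m≤o∸n b (subst (_≤ n) (ℕₚ.+-comm a b) a+b≤n)
    regroup : ∀ w x y z → w ℕ.* x ℕ.* (y ℕ.* z) ≡ w ℕ.* (y ℕ.* (x ℕ.* z))
    regroup = ℕ-Solver.solve-∀
  swap-factorials : r ! ℕ.* (j ! ℕ.* (n ∸ r ∸ j) !) ≡ j ! ℕ.* (r ! ℕ.* (n ∸ j ∸ r) !)
  swap-factorials = trans (exchange (r !) (j !) _) (cong (λ x → j ! ℕ.* (r ! ℕ.* x !)) ∸-comm)
    where
    exchange : ∀ x y z → x ℕ.* (y ℕ.* z) ≡ y ℕ.* (x ℕ.* z)
    exchange = ℕ-Solver.solve-∀
    ∸-comm : n ∸ r ∸ j ≡ n ∸ j ∸ r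
    ∸-comm = trans (ℕₚ.∸-+-assoc n r j)
                   (trans (cong (n ∸_) (ℕₚ.+-comm r j)) (sym (ℕₚ.∸-+-assoc n j r)))

[1+n]Ck*[1+n∸k]≡[1+n]*nCk : ∀ n k → (suc n C k) ℕ.* (suc n ∸ k) ≡ suc n ℕ.* (n C k)
[1+n]Ck*[1+n∸k]≡[1+n]*nCk n k with k ℕₚ.≤? n
... | no k≰n = begin
  (suc n C k) ℕ.* (suc n ∸ k)  ≡⟨ cong ((suc n C k) ℕ.*_) (ℕₚ.m≤n⇒m∸n≡0 n<k) ⟩
  (suc n C k) ℕ.* 0            ≡⟨ ℕₚ.*-zeroʳ (suc n C k) ⟩
  0                            ≡⟨ ℕₚ.*-zeroʳ (suc n) ⟨
  suc n ℕ.* 0                  ≡⟨ cong (suc n ℕ.*_) (k>n⇒nCk≡0 n<k) ⟨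
  suc n ℕ.* (n C k)            ∎
  where n<k = ℕₚ.≰⇒> k≰n
... | yes k≤n = ℕₚ.*-cancelʳ-≡ _ _ (k ! ℕ.* (n ∸ k) !) {{k !* (n ∸ k) !≢0}} (begin
  (suc n C k) ℕ.* (suc n ∸ k) ℕ.* (k ! ℕ.* (n ∸ k) !)
    ≡⟨ cong (λ d → (suc n C k) ℕ.* d ℕ.* (k ! ℕ.* (n ∸ k) !)) 1+n∸k≡1+[n∸k] ⟩
  (suc n C k) ℕ.* suc (n ∸ k) ℕ.* (k ! ℕ.* (n ∸ k) !)
    ≡⟨ regroup (suc n C k) (suc (n ∸ k)) (k !) ((n ∸ k) !) ⟩
  (suc n C k) ℕ.* (k ! ℕ.* suc (n ∸ k) !)
    ≡⟨ cong (λ d → (suc n C k) ℕ.* (k ! ℕ.* d !)) 1+n∸k≡1+[n∸k] ⟨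
  (suc n C k) ℕ.* (k ! ℕ.* (suc n ∸ k) !)
    ≡⟨ nCk*k!*[n∸k]!≡n! (ℕₚ.m≤n⇒m≤1+n k≤n) ⟩
  suc n !
    ≡⟨ cong (suc n ℕ.*_) (nCk*k!*[n∸k]!≡n! k≤n) ⟨
  suc n ℕ.* ((n C k) ℕ.* (k ! ℕ.* (n ∸ k) !))
    ≡⟨ ℕₚ.*-assoc (suc n) (n C k) _ ⟨
  suc n ℕ.* (n C k) ℕ.* (k ! ℕ.* (n ∸ k) !)  ∎)
  where
  1+n∸k≡1+[n∸k] = ℕₚ.+-∸-assoc 1 k≤n
  regroup : ∀ c s a f → c ℕ.* s ℕ.* (a ℕ.* f) ≡ c ℕ.* (a ℕ.* (s ℕ.* f))
  regroup = ℕ-Solver.solve-∀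

[2+n]Ck*[2+n∸k]*[1+n∸k]≡[2+n]*[1+n]*nCk : ∀ n k →
  (suc (suc n) C k) ℕ.* ((suc (suc n) ∸ k) ℕ.* (suc n ∸ k)) ≡ suc (suc n) ℕ.* suc n ℕ.* (n C k)
[2+n]Ck*[2+n∸k]*[1+n∸k]≡[2+n]*[1+n]*nCk n k = begin
  (suc (suc n) C k) ℕ.* ((suc (suc n) ∸ k) ℕ.* (suc n ∸ k))
    ≡⟨ ℕₚ.*-assoc (suc (suc n) C k) _ _ ⟨
  (suc (suc n) C k) ℕ.* (suc (suc n) ∸ k) ℕ.* (suc n ∸ k)
    ≡⟨ cong (ℕ._* (suc n ∸ k)) ([1+n]Ck*[1+n∸k]≡[1+n]*nCk (suc n) k) ⟩
  suc (suc n) ℕ.* (suc n C k) ℕ.* (suc n ∸ k)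
    ≡⟨ ℕₚ.*-assoc (suc (suc n)) (suc n C k) _ ⟩
  suc (suc n) ℕ.* ((suc n C k) ℕ.* (suc n ∸ k))
    ≡⟨ cong (suc (suc n) ℕ.*_) ([1+n]Ck*[1+n∸k]≡[1+n]*nCk n k) ⟩
  suc (suc n) ℕ.* (suc n ℕ.* (n C k))
    ≡⟨ ℕₚ.*-assoc (suc (suc n)) (suc n) (n C k) ⟨
  suc (suc n) ℕ.* suc n ℕ.* (n C k)  ∎

-- Times (n+2)(n+1), both sides become C(n+2,j) C(n+2-j,i) (n+2-j)(n+1-j)(n+2-i)(n+1-i).
nCj*[2+n∸j]Ci*[2+n∸i]*[1+n∸i]-symmetric : ∀ n i j → j ℕ.+ i ≤ suc (suc n) →
  (n C j) ℕ.* ((suc (suc n) ∸ j) C i) ℕ.* ((suc (suc n) ∸ i) ℕ.* (suc n ∸ i)) ≡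
  (n C i) ℕ.* ((suc (suc n) ∸ i) C j) ℕ.* ((suc (suc n) ∸ j) ℕ.* (suc n ∸ j))
nCj*[2+n∸j]Ci*[2+n∸i]*[1+n∸i]-symmetric n i j j+i≤N = ℕₚ.*-cancelʳ-≡ _ _ (N ℕ.* suc n) (begin
  (n C j) ℕ.* ((N ∸ j) C i) ℕ.* F i ℕ.* (N ℕ.* suc n)
    ≡⟨ expand j i ⟩
  (N C j) ℕ.* ((N ∸ j) C i) ℕ.* (F j ℕ.* F i)
    ≡⟨ cong₂ ℕ._*_ (nCj*[n∸j]Cr≡nCr*[n∸r]Cj {N} {j} {i} j+i≤N) (ℕₚ.*-comm (F j) (F i)) ⟩
  (N C i) ℕ.* ((N ∸ i) C j) ℕ.* (F i ℕ.* F j)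
    ≡⟨ expand i j ⟨
  (n C i) ℕ.* ((N ∸ i) C j) ℕ.* F j ℕ.* (N ℕ.* suc n)  ∎)
  where
  N = suc (suc n)
  F : ℕ → ℕ
  F k = (N ∸ k) ℕ.* (suc n ∸ k)
  expand : ∀ a b →
    (n C a) ℕ.* ((N ∸ a) C b) ℕ.* F b ℕ.* (N ℕ.* suc n) ≡ (N C a) ℕ.* ((N ∸ a) C b) ℕ.* (F a ℕ.* F b)
  expand a b = begin
    (n C a) ℕ.* ((N ∸ a) C b) ℕ.* F b ℕ.* (N ℕ.* suc n)
      ≡⟨ regroup (n C a) ((N ∸ a) C b) (F b) N (suc n) ⟩
    N ℕ.* suc n ℕ.* (n C a) ℕ.* (((N ∸ a) C b) ℕ.* F b)
      ≡⟨ cong (ℕ._* (((N ∸ a) C b) ℕ.* F b)) ([2+n]Ck*[2+n∸k]*[1+n∸k]≡[2+n]*[1+n]*nCk n a) ⟨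
    (N C a) ℕ.* F a ℕ.* (((N ∸ a) C b) ℕ.* F b)
      ≡⟨ interchange (N C a) (F a) ((N ∸ a) C b) (F b) ⟩
    (N C a) ℕ.* ((N ∸ a) C b) ℕ.* (F a ℕ.* F b)  ∎
    where
    regroup : ∀ c c′ f x y → c ℕ.* c′ ℕ.* f ℕ.* (x ℕ.* y) ≡ x ℕ.* y ℕ.* c ℕ.* (c′ ℕ.* f)
    regroup = ℕ-Solver.solve-∀
    interchange : ∀ w x y z → w ℕ.* x ℕ.* (y ℕ.* z) ≡ w ℕ.* y ℕ.* (x ℕ.* z)
    interchange = ℕ-Solver.solve-∀

-- Bernoulli numbers

δ₁ : ℕ → ℚ
δ₁ 1 = 1ℚ
δ₁ _ = 0ℚ

length-bernTable : ∀ n → length (bernTable n) ≡ suc n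
length-bernTable zero    = refl
length-bernTable (suc n) = trans (length-++ (bernTable n))
  (trans (cong (ℕ._+ 1) (length-bernTable n)) (ℕₚ.+-comm (suc n) 1))

nth-++ˡ : ∀ xs ys {k} → k < length xs → nth (xs ++ ys) k ≡ nth xs k
nth-++ˡ (x ∷ xs) ys {zero}  _              = refl
nth-++ˡ (x ∷ xs) ys {suc k} (s≤s k<∣xs∣) = nth-++ˡ xs ys k<∣xs∣

nth-∷ʳ-length : ∀ xs y → nth (xs ++ [ y ]) (length xs) ≡ y
nth-∷ʳ-length []       y = refl
nth-∷ʳ-length (x ∷ xs) y = nth-∷ʳ-length xs y

nth-bernTable : ∀ n {k} → k ≤ n → nth (bernTable n) k ≡ bernoulli k
nth-bernTable zero    z≤n = refl
nth-bernTable (suc n) {k} k≤1+n with ℕₚ.m≤n⇒m<n∨m≡n k≤1+n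
... | inj₂ refl  = refl
... | inj₁ k<1+n = trans (nth-++ˡ (bernTable n) _ (subst (k <_) (sym (length-bernTable n)) k<1+n))
                         (nth-bernTable n (ℕₚ.≤-pred k<1+n))

bernoulli-suc : ∀ n → bernoulli (suc n) ≡
  - (1/ℕ (suc (suc n)) * sumBelow (suc n) (λ k → ℕ→ℚ (suc (suc n) C k) * bernoulli k))
bernoulli-suc n = begin
  bernoulli (suc n)
    ≡⟨ subst (λ l → nth (bernTable n ++ [ b ]) l ≡ b) (length-bernTable n) (nth-∷ʳ-length (bernTable n) b) ⟩
  b
    ≡⟨ cong (λ s → - (1/ℕ (suc (suc n)) * s))
            (sumBelow-cong (suc n) (λ {k} → cong (ℕ→ℚ (suc (suc n) C k) *_) ∘ nth-bernTable n ∘ ℕₚ.≤-pred)) ⟩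
  - (1/ℕ (suc (suc n)) * sumBelow (suc n) (λ k → ℕ→ℚ (suc (suc n) C k) * bernoulli k))  ∎
  where
  b = - (1/ℕ (suc (suc n)) * sumBelow (suc n) (λ k → ℕ→ℚ (suc (suc n) C k) * nth (bernTable n) k))

bernoulli-recurrence : ∀ n → sumBelow (suc (suc n)) (λ k → ℕ→ℚ (suc (suc n) C k) * bernoulli k) ≡ 0ℚ
bernoulli-recurrence n = begin
  S + ℕ→ℚ (N C suc n) * bernoulli (suc n)  ≡⟨ cong₂ (λ c b → S + ℕ→ℚ c * b) ([1+n]Cn≡1+n (suc n)) (bernoulli-suc n) ⟩
  S + ℕ→ℚ N * - (1/ℕ N * S)                ≡⟨ regroup S (ℕ→ℚ N) (1/ℕ N) ⟩
  S - ℕ→ℚ N * 1/ℕ N * S                    ≡⟨ cong (λ u → S - u * S) (ℕ→ℚ-*-1/ℕ N) ⟩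
  S - 1ℚ * S                               ≡⟨ cancel S ⟩
  0ℚ                                       ∎
  where
  N = suc (suc n)
  S = sumBelow (suc n) (λ k → ℕ→ℚ (N C k) * bernoulli k)
  regroup : ∀ s p p′ → s + p * - (p′ * s) ≡ s - p * p′ * s
  regroup = solve-∀ ℚ-ring
  cancel : ∀ s → s - 1ℚ * s ≡ 0ℚ
  cancel = solve-∀ ℚ-ring

sumBelow-C*bernoulli : ∀ n → sumBelow (suc n) (λ k → ℕ→ℚ (n C k) * bernoulli k) ≡ bernoulli n + δ₁ n
sumBelow-C*bernoulli zero          = refl
sumBelow-C*bernoulli (suc zero)    = refl
sumBelow-C*bernoulli (suc (suc n)) = begin
  sumBelow (suc (suc n)) (λ k → ℕ→ℚ (N C k) * bernoulli k) + ℕ→ℚ (N C N) * bernoulli N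
    ≡⟨ cong₂ (λ s c → s + ℕ→ℚ c * bernoulli N) (bernoulli-recurrence n) (nCn≡1 N) ⟩
  0ℚ + 1ℚ * bernoulli N
    ≡⟨ trans (+-identityˡ _) (trans (*-identityˡ _) (sym (+-identityʳ (bernoulli N)))) ⟩
  bernoulli N + 0ℚ  ∎
  where N = suc (suc n)

-- Bernoulli polynomials and Faulhaber's formula

sumBelow-pascal : ∀ p (g : ℕ → ℚ) →
  sumBelow (suc (suc p)) (λ r → ℕ→ℚ (suc p C r) * g r) ≡ sumBelow (suc p) (λ r → ℕ→ℚ (p C r) * (g r + g (suc r)))
sumBelow-pascal p g = begin
  sumBelow (suc (suc p)) (λ r → ℕ→ℚ (suc p C r) * g r)
    ≡⟨ sumBelow-suc (suc p) _ ⟩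
  1ℚ * g 0 + sumBelow (suc p) (λ r → ℕ→ℚ (suc p C suc r) * g (suc r))
    ≡⟨ cong₂ _+_ (*-identityˡ (g 0)) (sumBelow-cong (suc p) (λ {r} _ → pascal r)) ⟩
  g 0 + sumBelow (suc p) (λ r → ℕ→ℚ (p C r) * g (suc r) + ℕ→ℚ (p C suc r) * g (suc r))
    ≡⟨ cong (_+_ (g 0)) (trans (sumBelow-+ (suc p) _ _) (+-comm lower upper)) ⟩
  g 0 + (upper + lower)
    ≡⟨ +-assoc (g 0) upper lower ⟨
  g 0 + upper + lower
    ≡⟨ cong (_+ lower) split-first ⟨
  sumBelow (suc p) (λ r → ℕ→ℚ (p C r) * g r) + lower
    ≡⟨ sumBelow-+ (suc p) _ _ ⟨
  sumBelow (suc p) (λ r → ℕ→ℚ (p C r) * g r + ℕ→ℚ (p C r) * g (suc r))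
    ≡⟨ sumBelow-cong (suc p) (λ {r} _ → *-distribˡ-+ (ℕ→ℚ (p C r)) (g r) (g (suc r))) ⟨
  sumBelow (suc p) (λ r → ℕ→ℚ (p C r) * (g r + g (suc r)))  ∎
  where
  lower = sumBelow (suc p) (λ r → ℕ→ℚ (p C r) * g (suc r))
  upper = sumBelow (suc p) (λ r → ℕ→ℚ (p C suc r) * g (suc r))
  pascal : ∀ r → ℕ→ℚ (suc p C suc r) * g (suc r) ≡ ℕ→ℚ (p C r) * g (suc r) + ℕ→ℚ (p C suc r) * g (suc r)
  pascal r = begin
    ℕ→ℚ (suc p C suc r) * g (suc r)
      ≡⟨ cong (λ c → ℕ→ℚ c * g (suc r)) (nCk+nC[k+1]≡[n+1]C[k+1] p r) ⟨
    ℕ→ℚ ((p C r) ℕ.+ (p C suc r)) * g (suc r)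
      ≡⟨ cong (_* g (suc r)) (ℕ→ℚ-+ (p C r) (p C suc r)) ⟩
    (ℕ→ℚ (p C r) + ℕ→ℚ (p C suc r)) * g (suc r)
      ≡⟨ *-distribʳ-+ (g (suc r)) (ℕ→ℚ (p C r)) (ℕ→ℚ (p C suc r)) ⟩
    ℕ→ℚ (p C r) * g (suc r) + ℕ→ℚ (p C suc r) * g (suc r)  ∎
  split-first : sumBelow (suc p) (λ r → ℕ→ℚ (p C r) * g r) ≡ g 0 + upper
  split-first = begin
    sumBelow (suc p) (λ r → ℕ→ℚ (p C r) * g r)
      ≡⟨ sumBelow-suc p _ ⟩
    1ℚ * g 0 + sumBelow p (λ r → ℕ→ℚ (p C suc r) * g (suc r))
      ≡⟨ cong₂ _+_ (*-identityˡ (g 0)) (sym last-vanishes) ⟩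
    g 0 + upper  ∎
    where
    last-vanishes : upper ≡ sumBelow p (λ r → ℕ→ℚ (p C suc r) * g (suc r))
    last-vanishes = trans (cong (λ c → earlier + ℕ→ℚ c * g (suc p)) (k>n⇒nCk≡0 (ℕₚ.n<1+n p)))
                          (trans (cong (_+_ earlier) (*-zeroˡ (g (suc p)))) (+-identityʳ earlier))
      where earlier = sumBelow p (λ r → ℕ→ℚ (p C suc r) * g (suc r))

binomial-theorem : ∀ p x → (x + 1ℚ) ^ℚ p ≡ sumBelow (suc p) (λ r → ℕ→ℚ (p C r) * x ^ℚ r)
binomial-theorem zero    x = refl
binomial-theorem (suc p) x = begin
  (x + 1ℚ) * (x + 1ℚ) ^ℚ p
    ≡⟨ cong ((x + 1ℚ) *_) (binomial-theorem p x) ⟩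
  (x + 1ℚ) * sumBelow (suc p) (λ r → ℕ→ℚ (p C r) * x ^ℚ r)
    ≡⟨ sumBelow-*ˡ (suc p) (x + 1ℚ) _ ⟩
  sumBelow (suc p) (λ r → (x + 1ℚ) * (ℕ→ℚ (p C r) * x ^ℚ r))
    ≡⟨ sumBelow-cong (suc p) (λ {r} _ → distribute x (ℕ→ℚ (p C r)) (x ^ℚ r)) ⟩
  sumBelow (suc p) (λ r → ℕ→ℚ (p C r) * (x ^ℚ r + x ^ℚ suc r))
    ≡⟨ sumBelow-pascal p (x ^ℚ_) ⟨
  sumBelow (suc (suc p)) (λ r → ℕ→ℚ (suc p C r) * x ^ℚ r)  ∎
  where
  distribute : ∀ x c y → (x + 1ℚ) * (c * y) ≡ c * (y + x * y)
  distribute = solve-∀ ℚ-ring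

bernoulliPoly-reverse : ∀ n x →
  bernoulliPoly n x ≡ sumBelow (suc n) (λ r → ℕ→ℚ (n C r) * bernoulli (n ∸ r) * x ^ℚ r)
bernoulliPoly-reverse n x = trans (sumBelow-reverse n _) (sumBelow-cong (suc n) (λ {r} r<1+n →
  let r≤n = ℕₚ.≤-pred r<1+n in
  cong₂ (λ c e → ℕ→ℚ c * bernoulli (n ∸ r) * x ^ℚ e) (sym (nCk≡nC[n∸k] r≤n)) (ℕₚ.m∸[m∸n]≡n r≤n)))

bernoulliPoly-0 : ∀ n → bernoulliPoly n 0ℚ ≡ bernoulli n
bernoulliPoly-0 n = begin
  bernoulliPoly n 0ℚ
    ≡⟨ trans (bernoulliPoly-reverse n 0ℚ) (sumBelow-suc n _) ⟩
  1ℚ * bernoulli n * 1ℚ + sumBelow n (λ r → ℕ→ℚ (n C suc r) * bernoulli (n ∸ suc r) * (0ℚ * 0ℚ ^ℚ r))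
    ≡⟨ cong₂ _+_ (trans (*-identityʳ (1ℚ * bernoulli n)) (*-identityˡ (bernoulli n)))
                 (trans (sumBelow-cong n vanishes) (sumBelow-0 n)) ⟩
  bernoulli n + 0ℚ
    ≡⟨ +-identityʳ (bernoulli n) ⟩
  bernoulli n  ∎
  where
  vanishes : ∀ {r} → r < n → ℕ→ℚ (n C suc r) * bernoulli (n ∸ suc r) * (0ℚ * 0ℚ ^ℚ r) ≡ 0ℚ
  vanishes {r} _ = trans (cong (c *_) (*-zeroˡ (0ℚ ^ℚ r))) (*-zeroʳ c)
    where c = ℕ→ℚ (n C suc r) * bernoulli (n ∸ suc r)

bernoulliPoly-+1 : ∀ n x →
  bernoulliPoly n (x + 1ℚ) ≡ sumBelow (suc n) (λ r → ℕ→ℚ (n C r) * x ^ℚ r * (bernoulli (n ∸ r) + δ₁ (n ∸ r)))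
bernoulliPoly-+1 n x = begin
  sumBelow (suc n) (λ j → ℕ→ℚ (n C j) * bernoulli j * (x + 1ℚ) ^ℚ (n ∸ j))
    ≡⟨ sumBelow-cong (suc n) expand ⟩
  sumBelow (suc n) (λ j → sumBelow (suc n ∸ j) (T j))
    ≡⟨ sumBelow-triangle (suc n) T ⟩
  sumBelow (suc n) (λ r → sumBelow (suc n ∸ r) (λ j → T j r))
    ≡⟨ sumBelow-cong (suc n) collect ⟩
  sumBelow (suc n) (λ r → ℕ→ℚ (n C r) * x ^ℚ r * (bernoulli (n ∸ r) + δ₁ (n ∸ r)))  ∎
  where
  T : ℕ → ℕ → ℚ
  T j r = ℕ→ℚ (n C j) * bernoulli j * (ℕ→ℚ ((n ∸ j) C r) * x ^ℚ r)

  expand : ∀ {j} → j < suc n → ℕ→ℚ (n C j) * bernoulli j * (x + 1ℚ) ^ℚ (n ∸ j) ≡ sumBelow (suc n ∸ j) (T j)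
  expand {j} j<1+n = begin
    ℕ→ℚ (n C j) * bernoulli j * (x + 1ℚ) ^ℚ (n ∸ j)
      ≡⟨ cong (ℕ→ℚ (n C j) * bernoulli j *_) (binomial-theorem (n ∸ j) x) ⟩
    ℕ→ℚ (n C j) * bernoulli j * sumBelow (suc (n ∸ j)) (λ r → ℕ→ℚ ((n ∸ j) C r) * x ^ℚ r)
      ≡⟨ sumBelow-*ˡ (suc (n ∸ j)) (ℕ→ℚ (n C j) * bernoulli j) (λ r → ℕ→ℚ ((n ∸ j) C r) * x ^ℚ r) ⟩
    sumBelow (suc (n ∸ j)) (T j)
      ≡⟨ cong (λ l → sumBelow l (T j)) (ℕₚ.+-∸-assoc 1 (ℕₚ.≤-pred j<1+n)) ⟨
    sumBelow (suc n ∸ j) (T j)  ∎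

  exchange : ∀ {j r} → j ℕ.+ r ≤ n → T j r ≡ ℕ→ℚ (n C r) * x ^ℚ r * (ℕ→ℚ ((n ∸ r) C j) * bernoulli j)
  exchange {j} {r} j+r≤n = begin
    T j r                                                        ≡⟨ regroup (ℕ→ℚ (n C j)) (bernoulli j) _ (x ^ℚ r) ⟩
    ℕ→ℚ (n C j) * ℕ→ℚ ((n ∸ j) C r) * (x ^ℚ r * bernoulli j)    ≡⟨ cong (_* (x ^ℚ r * bernoulli j)) C*C≡C*C ⟩
    ℕ→ℚ (n C r) * ℕ→ℚ ((n ∸ r) C j) * (x ^ℚ r * bernoulli j)    ≡⟨ *-interchange (ℕ→ℚ (n C r)) _ (x ^ℚ r) _ ⟩
    ℕ→ℚ (n C r) * x ^ℚ r * (ℕ→ℚ ((n ∸ r) C j) * bernoulli j)    ∎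
    where
    regroup : ∀ a b c y → a * b * (c * y) ≡ a * c * (y * b)
    regroup = solve-∀ ℚ-ring
    C*C≡C*C : ℕ→ℚ (n C j) * ℕ→ℚ ((n ∸ j) C r) ≡ ℕ→ℚ (n C r) * ℕ→ℚ ((n ∸ r) C j)
    C*C≡C*C = trans (sym (ℕ→ℚ-* (n C j) ((n ∸ j) C r)))
                    (trans (cong ℕ→ℚ (nCj*[n∸j]Cr≡nCr*[n∸r]Cj {n} {j} {r} j+r≤n)) (ℕ→ℚ-* (n C r) ((n ∸ r) C j)))

  collect : ∀ {r} → r < suc n →
    sumBelow (suc n ∸ r) (λ j → T j r) ≡ ℕ→ℚ (n C r) * x ^ℚ r * (bernoulli (n ∸ r) + δ₁ (n ∸ r))
  collect {r} r<1+n = begin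
    sumBelow (suc n ∸ r) (λ j → T j r)
      ≡⟨ cong (λ l → sumBelow l (λ j → T j r)) (ℕₚ.+-∸-assoc 1 r≤n) ⟩
    sumBelow (suc (n ∸ r)) (λ j → T j r)
      ≡⟨ sumBelow-cong (suc (n ∸ r)) (λ {j} → exchange {j} {r} ∘ ℕₚ.m≤o∸n⇒m+n≤o j r≤n ∘ ℕₚ.≤-pred) ⟩
    sumBelow (suc (n ∸ r)) (λ j → ℕ→ℚ (n C r) * x ^ℚ r * (ℕ→ℚ ((n ∸ r) C j) * bernoulli j))
      ≡⟨ sumBelow-*ˡ (suc (n ∸ r)) (ℕ→ℚ (n C r) * x ^ℚ r) (λ j → ℕ→ℚ ((n ∸ r) C j) * bernoulli j) ⟨
    ℕ→ℚ (n C r) * x ^ℚ r * sumBelow (suc (n ∸ r)) (λ j → ℕ→ℚ ((n ∸ r) C j) * bernoulli j)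
      ≡⟨ cong (ℕ→ℚ (n C r) * x ^ℚ r *_) (sumBelow-C*bernoulli (n ∸ r)) ⟩
    ℕ→ℚ (n C r) * x ^ℚ r * (bernoulli (n ∸ r) + δ₁ (n ∸ r))  ∎
    where r≤n = ℕₚ.≤-pred r<1+n

bernoulliPoly-difference : ∀ q x →
  bernoulliPoly (suc q) (x + 1ℚ) ≡ bernoulliPoly (suc q) x + ℕ→ℚ (suc q) * x ^ℚ q
bernoulliPoly-difference q x = begin
  bernoulliPoly N (x + 1ℚ)
    ≡⟨ bernoulliPoly-+1 N x ⟩
  sumBelow (suc N) (λ r → P r * (bernoulli (N ∸ r) + δ₁ (N ∸ r)))
    ≡⟨ sumBelow-cong (suc N) (λ {r} _ → *-distribˡ-+ (P r) (bernoulli (N ∸ r)) (δ₁ (N ∸ r))) ⟩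
  sumBelow (suc N) (λ r → P r * bernoulli (N ∸ r) + P r * δ₁ (N ∸ r))
    ≡⟨ sumBelow-+ (suc N) _ _ ⟩
  sumBelow (suc N) (λ r → P r * bernoulli (N ∸ r)) + sumBelow (suc N) (λ r → P r * δ₁ (N ∸ r))
    ≡⟨ cong₂ _+_ (trans (sumBelow-cong (suc N) (λ {r} _ → swap (ℕ→ℚ (N C r)) (x ^ℚ r) (bernoulli (N ∸ r))))
                        (sym (bernoulliPoly-reverse N x)))
                 δ₁-sum ⟩
  bernoulliPoly N x + ℕ→ℚ N * x ^ℚ q  ∎
  where
  N = suc q
  P : ℕ → ℚ
  P r = ℕ→ℚ (N C r) * x ^ℚ r
  swap : ∀ a b c → a * b * c ≡ a * c * b
  swap = solve-∀ ℚ-ring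
  δ₁-sum : sumBelow (suc N) (λ r → P r * δ₁ (N ∸ r)) ≡ ℕ→ℚ N * x ^ℚ q
  δ₁-sum = begin
    sumBelow q g + g q + g N
      ≡⟨ cong₂ _+_ (cong₂ _+_ (trans (sumBelow-cong q below-q) (sumBelow-0 q)) at-q) at-N ⟩
    0ℚ + ℕ→ℚ N * x ^ℚ q * 1ℚ + 0ℚ
      ≡⟨ simplify (ℕ→ℚ N * x ^ℚ q) ⟩
    ℕ→ℚ N * x ^ℚ q  ∎
    where
    g : ℕ → ℚ
    g r = P r * δ₁ (N ∸ r)
    below-q : ∀ {r} → r < q → g r ≡ 0ℚ
    below-q {r} r<q = trans (cong (λ d → P r * δ₁ d) N∸r≡2+[q∸1+r]) (*-zeroʳ (P r))
      where N∸r≡2+[q∸1+r] = trans (ℕₚ.+-∸-assoc 1 (ℕₚ.<⇒≤ r<q)) (cong suc (ℕₚ.+-∸-assoc 1 r<q))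
    at-q : g q ≡ ℕ→ℚ N * x ^ℚ q * 1ℚ
    at-q = cong₂ (λ c d → ℕ→ℚ c * x ^ℚ q * δ₁ d) ([1+n]Cn≡1+n q) (ℕₚ.m+n∸n≡m 1 q)
    at-N : g N ≡ 0ℚ
    at-N = trans (cong (λ d → P N * δ₁ d) (ℕₚ.n∸n≡0 q)) (*-zeroʳ (P N))
    simplify : ∀ y → 0ℚ + y * 1ℚ + 0ℚ ≡ y
    simplify = solve-∀ ℚ-ring

powerSum : ℕ → ℕ → ℚ
powerSum q m = sumBelow m (λ k → ℕ→ℚ k ^ℚ q)

faulhaber-bernoulliPoly : ∀ q m →
  ℕ→ℚ (suc q) * powerSum q m ≡ bernoulliPoly (suc q) (ℕ→ℚ m) - bernoulli (suc q)
faulhaber-bernoulliPoly q zero = begin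
  ℕ→ℚ (suc q) * 0ℚ                               ≡⟨ *-zeroʳ (ℕ→ℚ (suc q)) ⟩
  0ℚ                                             ≡⟨ +-inverseʳ (bernoulli (suc q)) ⟨
  bernoulli (suc q) - bernoulli (suc q)          ≡⟨ cong (_- bernoulli (suc q)) (bernoulliPoly-0 (suc q)) ⟨
  bernoulliPoly (suc q) 0ℚ - bernoulli (suc q)   ∎
faulhaber-bernoulliPoly q (suc m) = begin
  ℕ→ℚ (suc q) * (powerSum q m + M ^ℚ q)
    ≡⟨ *-distribˡ-+ (ℕ→ℚ (suc q)) (powerSum q m) (M ^ℚ q) ⟩
  ℕ→ℚ (suc q) * powerSum q m + ℕ→ℚ (suc q) * M ^ℚ q
    ≡⟨ cong (_+ ℕ→ℚ (suc q) * M ^ℚ q) (faulhaber-bernoulliPoly q m) ⟩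
  bernoulliPoly (suc q) M - bernoulli (suc q) + ℕ→ℚ (suc q) * M ^ℚ q
    ≡⟨ rearrange (bernoulliPoly (suc q) M) (bernoulli (suc q)) _ ⟩
  bernoulliPoly (suc q) M + ℕ→ℚ (suc q) * M ^ℚ q - bernoulli (suc q)
    ≡⟨ cong (_- bernoulli (suc q)) (bernoulliPoly-difference q M) ⟨
  bernoulliPoly (suc q) (M + 1ℚ) - bernoulli (suc q)
    ≡⟨ cong (λ y → bernoulliPoly (suc q) y - bernoulli (suc q)) (trans (+-comm M 1ℚ) (sym (ℕ→ℚ-+ 1 m))) ⟩
  bernoulliPoly (suc q) (ℕ→ℚ (suc m)) - bernoulli (suc q)  ∎
  where
  M = ℕ→ℚ m
  rearrange : ∀ a b c → a - b + c ≡ a + c - b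
  rearrange = solve-∀ ℚ-ring

faulhaber : ∀ q m → ℕ→ℚ (suc q) * powerSum q m ≡
  sumBelow (suc q) (λ i → ℕ→ℚ (suc q C i) * bernoulli i * ℕ→ℚ m ^ℚ (suc q ∸ i))
faulhaber q m = begin
  ℕ→ℚ (suc q) * powerSum q m
    ≡⟨ faulhaber-bernoulliPoly q m ⟩
  S + ℕ→ℚ (suc q C suc q) * B * ℕ→ℚ m ^ℚ (suc q ∸ suc q) - B
    ≡⟨ cong₂ (λ c e → S + ℕ→ℚ c * B * ℕ→ℚ m ^ℚ e - B) (nCn≡1 (suc q)) (ℕₚ.n∸n≡0 q) ⟩
  S + 1ℚ * B * 1ℚ - B
    ≡⟨ cancel S B ⟩
  S  ∎
  where
  B = bernoulli (suc q)
  S = sumBelow (suc q) (λ i → ℕ→ℚ (suc q C i) * bernoulli i * ℕ→ℚ m ^ℚ (suc q ∸ i))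
  cancel : ∀ s b → s + 1ℚ * b * 1ℚ - b ≡ s
  cancel = solve-∀ ℚ-ring

sumBelow-*-bernoulliPoly : ∀ m n (x : ℕ → ℚ) →
  sumBelow m (λ k → x k * bernoulliPoly n (x k)) ≡
  sumBelow (suc n) (λ j → ℕ→ℚ (n C j) * bernoulli j * sumBelow m (λ k → x k ^ℚ suc (n ∸ j)))
sumBelow-*-bernoulliPoly m n x = begin
  sumBelow m (λ k → x k * bernoulliPoly n (x k))
    ≡⟨ sumBelow-cong m (λ {k} _ → trans (sumBelow-*ˡ (suc n) (x k) _)
                                         (sumBelow-cong (suc n) (λ {j} _ → absorb (x k) (c j) (x k ^ℚ (n ∸ j))))) ⟩
  sumBelow m (λ k → sumBelow (suc n) (λ j → c j * x k ^ℚ suc (n ∸ j)))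
    ≡⟨ sumBelow-swap m (suc n) _ ⟩
  sumBelow (suc n) (λ j → sumBelow m (λ k → c j * x k ^ℚ suc (n ∸ j)))
    ≡⟨ sumBelow-cong (suc n) (λ {j} _ → sumBelow-*ˡ m (c j) _) ⟨
  sumBelow (suc n) (λ j → c j * sumBelow m (λ k → x k ^ℚ suc (n ∸ j)))  ∎
  where
  c : ℕ → ℚ
  c j = ℕ→ℚ (n C j) * bernoulli j
  absorb : ∀ y c z → y * (c * z) ≡ c * (y * z)
  absorb = solve-∀ ℚ-ring

-- The coefficient of B_i m^{n-i}

sumBelow-C*[n∸j]*bernoulli : ∀ n →
  sumBelow (suc n) (λ j → ℕ→ℚ (suc n C j) * ℕ→ℚ (suc n ∸ j) * bernoulli j) ≡
  ℕ→ℚ (suc n) * (bernoulli n + δ₁ n)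
sumBelow-C*[n∸j]*bernoulli n = begin
  sumBelow (suc n) (λ j → ℕ→ℚ (suc n C j) * ℕ→ℚ (suc n ∸ j) * bernoulli j)
    ≡⟨ sumBelow-cong (suc n) (λ {j} _ → absorb j) ⟩
  sumBelow (suc n) (λ j → ℕ→ℚ (suc n) * (ℕ→ℚ (n C j) * bernoulli j))
    ≡⟨ sumBelow-*ˡ (suc n) (ℕ→ℚ (suc n)) _ ⟨
  ℕ→ℚ (suc n) * sumBelow (suc n) (λ j → ℕ→ℚ (n C j) * bernoulli j)
    ≡⟨ cong (ℕ→ℚ (suc n) *_) (sumBelow-C*bernoulli n) ⟩
  ℕ→ℚ (suc n) * (bernoulli n + δ₁ n)  ∎
  where
  absorb : ∀ j → ℕ→ℚ (suc n C j) * ℕ→ℚ (suc n ∸ j) * bernoulli j ≡ ℕ→ℚ (suc n) * (ℕ→ℚ (n C j) * bernoulli j)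
  absorb j = begin
    ℕ→ℚ (suc n C j) * ℕ→ℚ (suc n ∸ j) * bernoulli j
      ≡⟨ cong (_* bernoulli j) (ℕ→ℚ-* (suc n C j) (suc n ∸ j)) ⟨
    ℕ→ℚ ((suc n C j) ℕ.* (suc n ∸ j)) * bernoulli j
      ≡⟨ cong (λ c → ℕ→ℚ c * bernoulli j) ([1+n]Ck*[1+n∸k]≡[1+n]*nCk n j) ⟩
    ℕ→ℚ (suc n ℕ.* (n C j)) * bernoulli j
      ≡⟨ cong (_* bernoulli j) (ℕ→ℚ-* (suc n) (n C j)) ⟩
    ℕ→ℚ (suc n) * ℕ→ℚ (n C j) * bernoulli j
      ≡⟨ *-assoc (ℕ→ℚ (suc n)) _ _ ⟩
    ℕ→ℚ (suc n) * (ℕ→ℚ (n C j) * bernoulli j)  ∎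

-- 1+i+e-j = (i - 1) + (e+2-j), and the constant part is killed by bernoulli-recurrence.
sumBelow-C*[1+i+e∸j]*bernoulli : ∀ i e →
  sumBelow (suc (suc e)) (λ j → ℕ→ℚ (suc (suc e) C j) * ℕ→ℚ (suc (i ℕ.+ e) ∸ j) * bernoulli j) ≡
  ℕ→ℚ (suc (suc e)) * (bernoulli (suc e) + δ₁ (suc e))
sumBelow-C*[1+i+e∸j]*bernoulli i e = begin
  sumBelow E (λ j → C′ j * w j * bernoulli j)
    ≡⟨ +-identityʳ _ ⟨
  sumBelow E (λ j → C′ j * w j * bernoulli j) + 0ℚ
    ≡⟨ cong (_+_ (sumBelow E (λ j → C′ j * w j * bernoulli j))) (bernoulli-recurrence e) ⟨
  sumBelow E (λ j → C′ j * w j * bernoulli j) + sumBelow E (λ j → C′ j * bernoulli j)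
    ≡⟨ sumBelow-+ E _ _ ⟨
  sumBelow E (λ j → C′ j * w j * bernoulli j + C′ j * bernoulli j)
    ≡⟨ sumBelow-cong E (λ {j} → shift-weight (C′ j) (w j) (bernoulli j) (ℕ→ℚ i) _ ∘ weight j ∘ ℕₚ.≤-pred) ⟩
  sumBelow E (λ j → ℕ→ℚ i * (C′ j * bernoulli j) + C′ j * ℕ→ℚ (E ∸ j) * bernoulli j)
    ≡⟨ sumBelow-+ E _ _ ⟩
  sumBelow E (λ j → ℕ→ℚ i * (C′ j * bernoulli j)) + sumBelow E (λ j → C′ j * ℕ→ℚ (E ∸ j) * bernoulli j)
    ≡⟨ cong₂ _+_ (trans (sym (sumBelow-*ˡ E (ℕ→ℚ i) _))
                        (trans (cong (ℕ→ℚ i *_) (bernoulli-recurrence e)) (*-zeroʳ (ℕ→ℚ i))))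
                 (sumBelow-C*[n∸j]*bernoulli (suc e)) ⟩
  0ℚ + ℕ→ℚ E * (bernoulli (suc e) + δ₁ (suc e))
    ≡⟨ +-identityˡ _ ⟩
  ℕ→ℚ E * (bernoulli (suc e) + δ₁ (suc e))  ∎
  where
  E = suc (suc e)
  C′ : ℕ → ℚ
  C′ j = ℕ→ℚ (E C j)
  w : ℕ → ℚ
  w j = ℕ→ℚ (suc (i ℕ.+ e) ∸ j)
  weight : ∀ j → j ≤ suc e → w j + 1ℚ ≡ ℕ→ℚ i + ℕ→ℚ (E ∸ j)
  weight j j≤1+e = trans (sym (ℕ→ℚ-+ (suc (i ℕ.+ e) ∸ j) 1)) (trans (cong ℕ→ℚ (begin
    suc (i ℕ.+ e) ∸ j ℕ.+ 1   ≡⟨ ℕₚ.+-comm _ 1 ⟩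
    suc (suc (i ℕ.+ e) ∸ j)   ≡⟨ ℕₚ.+-∸-assoc 1 (ℕₚ.≤-trans j≤1+e (s≤s (ℕₚ.m≤n+m e i))) ⟨
    suc (suc (i ℕ.+ e)) ∸ j   ≡⟨ cong (_∸ j) (trans (cong suc (sym (ℕₚ.+-suc i e))) (sym (ℕₚ.+-suc i (suc e)))) ⟩
    i ℕ.+ E ∸ j               ≡⟨ ℕₚ.+-∸-assoc i (ℕₚ.m≤n⇒m≤1+n j≤1+e) ⟩
    i ℕ.+ (E ∸ j)             ∎)) (ℕ→ℚ-+ i (E ∸ j)))
  shift-weight : ∀ c w b x y → w + 1ℚ ≡ x + y → c * w * b + c * b ≡ x * (c * b) + c * y * b
  shift-weight c w b x y w+1≡x+y =
    trans (distribute c w b) (trans (cong (λ u → c * u * b) w+1≡x+y) (distribute′ c x y b))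
    where
    distribute : ∀ c w b → c * w * b + c * b ≡ c * (w + 1ℚ) * b
    distribute = solve-∀ ℚ-ring
    distribute′ : ∀ c x y b → c * (x + y) * b ≡ x * (c * b) + c * y * b
    distribute′ = solve-∀ ℚ-ring

-- suc (suc n ∸ j) is n+2-j only for j ≤ n+1, the only j that occur.
κ : ℕ → ℕ → ℕ → ℚ
κ n j i = ℕ→ℚ (n C j) * ℕ→ℚ (suc (suc n ∸ j) C i) * 1/ℕ (suc (suc n ∸ j))

κ-closed-form : ∀ i e {j} → j ≤ suc e →
  κ (i ℕ.+ e) j i ≡
  ℕ→ℚ ((i ℕ.+ e) C i) * ℕ→ℚ (suc (suc e) C j) * ℕ→ℚ (suc (i ℕ.+ e) ∸ j) * (1/ℕ (suc (suc e)) * 1/ℕ (suc e))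
κ-closed-form i e {j} j≤1+e =
  a*p≡b*q⇒a*q′≡b*p′ {a = ℕ→ℚ (n C j) * ℕ→ℚ (Q C i)} {b = ℕ→ℚ (n C i) * ℕ→ℚ (E₂ C j) * ℕ→ℚ (suc n ∸ j)}
    p*p′≡1 (ℕ→ℚ-*-1/ℕ Q) (begin
      ℕ→ℚ (n C j) * ℕ→ℚ (Q C i) * (ℕ→ℚ E₂ * ℕ→ℚ E₁)
        ≡⟨ ℕ→ℚ-*-* (n C j) (Q C i) E₂ E₁ ⟨
      ℕ→ℚ ((n C j) ℕ.* (Q C i) ℕ.* (E₂ ℕ.* E₁))
        ≡⟨ cong ℕ→ℚ exchange ⟩
      ℕ→ℚ ((n C i) ℕ.* (E₂ C j) ℕ.* (Q ℕ.* (suc n ∸ j)))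
        ≡⟨ ℕ→ℚ-*-* (n C i) (E₂ C j) Q (suc n ∸ j) ⟩
      ℕ→ℚ (n C i) * ℕ→ℚ (E₂ C j) * (ℕ→ℚ Q * ℕ→ℚ (suc n ∸ j))
        ≡⟨ regroup (ℕ→ℚ (n C i) * ℕ→ℚ (E₂ C j)) (ℕ→ℚ Q) _ ⟩
      ℕ→ℚ (n C i) * ℕ→ℚ (E₂ C j) * ℕ→ℚ (suc n ∸ j) * ℕ→ℚ Q  ∎)
  where
  n  = i ℕ.+ e
  Q  = suc (suc n ∸ j)
  E₂ = suc (suc e)
  E₁ = suc e
  p*p′≡1 : ℕ→ℚ E₂ * ℕ→ℚ E₁ * (1/ℕ E₂ * 1/ℕ E₁) ≡ 1ℚ
  p*p′≡1 = trans (*-interchange (ℕ→ℚ E₂) _ _ _) (cong₂ _*_ (ℕ→ℚ-*-1/ℕ E₂) (ℕ→ℚ-*-1/ℕ E₁))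
  ℕ→ℚ-*-* : ∀ a b c d → ℕ→ℚ (a ℕ.* b ℕ.* (c ℕ.* d)) ≡ ℕ→ℚ a * ℕ→ℚ b * (ℕ→ℚ c * ℕ→ℚ d)
  ℕ→ℚ-*-* a b c d = trans (ℕ→ℚ-* (a ℕ.* b) _) (cong₂ _*_ (ℕ→ℚ-* a b) (ℕ→ℚ-* c d))
  regroup : ∀ x q d → x * (q * d) ≡ x * d * q
  regroup = solve-∀ ℚ-ring
  2+n∸j≡Q : suc (suc n) ∸ j ≡ Q
  2+n∸j≡Q = ℕₚ.+-∸-assoc 1 (ℕₚ.≤-trans j≤1+e (s≤s (ℕₚ.m≤n+m e i)))
  k+n∸i≡k+e : ∀ k → k ℕ.+ n ∸ i ≡ k ℕ.+ e
  k+n∸i≡k+e k = trans (ℕₚ.+-∸-assoc k (ℕₚ.m≤m+n i e)) (cong (k ℕ.+_) (ℕₚ.m+n∸m≡n i e))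
  exchange : (n C j) ℕ.* (Q C i) ℕ.* (E₂ ℕ.* E₁) ≡ (n C i) ℕ.* (E₂ C j) ℕ.* (Q ℕ.* (suc n ∸ j))
  exchange = begin
    (n C j) ℕ.* (Q C i) ℕ.* (E₂ ℕ.* E₁)
      ≡⟨ cong₂ (λ q f → (n C j) ℕ.* (q C i) ℕ.* f) 2+n∸j≡Q (cong₂ ℕ._*_ (k+n∸i≡k+e 2) (k+n∸i≡k+e 1)) ⟨
    (n C j) ℕ.* ((suc (suc n) ∸ j) C i) ℕ.* ((suc (suc n) ∸ i) ℕ.* (suc n ∸ i))
      ≡⟨ nCj*[2+n∸j]Ci*[2+n∸i]*[1+n∸i]-symmetric n i j j+i≤2+n ⟩
    (n C i) ℕ.* ((suc (suc n) ∸ i) C j) ℕ.* ((suc (suc n) ∸ j) ℕ.* (suc n ∸ j))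
      ≡⟨ cong₂ (λ e₂ q → (n C i) ℕ.* (e₂ C j) ℕ.* (q ℕ.* (suc n ∸ j))) (k+n∸i≡k+e 2) 2+n∸j≡Q ⟩
    (n C i) ℕ.* (E₂ C j) ℕ.* (Q ℕ.* (suc n ∸ j))  ∎
    where
    j+i≤2+n = ℕₚ.m≤n⇒m≤1+n (ℕₚ.≤-trans (ℕₚ.+-monoˡ-≤ i j≤1+e)
                                       (ℕₚ.≤-reflexive (cong suc (ℕₚ.+-comm e i))))

sumBelow-κ*bernoulli : ∀ i e →
  sumBelow (suc (suc e)) (λ j → κ (i ℕ.+ e) j i * bernoulli j) ≡
  ℕ→ℚ ((i ℕ.+ e) C i) * (bernoulli (suc e) + δ₁ (suc e)) * 1/ℕ (suc e)
sumBelow-κ*bernoulli i e = begin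
  sumBelow E₂ (λ j → κ n j i * bernoulli j)
    ≡⟨ sumBelow-cong E₂ (λ {j} j<E₂ → trans (cong (_* bernoulli j) (κ-closed-form i e (ℕₚ.≤-pred j<E₂)))
                                             (regroup (ℕ→ℚ (n C i)) _ _ (1/ℕ E₂ * 1/ℕ E₁) (bernoulli j))) ⟩
  sumBelow E₂ (λ j → K * (ℕ→ℚ (E₂ C j) * ℕ→ℚ (suc n ∸ j) * bernoulli j))
    ≡⟨ sumBelow-*ˡ E₂ K _ ⟨
  K * sumBelow E₂ (λ j → ℕ→ℚ (E₂ C j) * ℕ→ℚ (suc n ∸ j) * bernoulli j)
    ≡⟨ cong (K *_) (sumBelow-C*[1+i+e∸j]*bernoulli i e) ⟩
  K * (ℕ→ℚ E₂ * β)
    ≡⟨ regroup′ (ℕ→ℚ (n C i)) (1/ℕ E₂) (1/ℕ E₁) (ℕ→ℚ E₂) β ⟩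
  ℕ→ℚ (n C i) * β * 1/ℕ E₁ * (ℕ→ℚ E₂ * 1/ℕ E₂)
    ≡⟨ trans (cong (ℕ→ℚ (n C i) * β * 1/ℕ E₁ *_) (ℕ→ℚ-*-1/ℕ E₂)) (*-identityʳ _) ⟩
  ℕ→ℚ (n C i) * β * 1/ℕ E₁  ∎
  where
  n  = i ℕ.+ e
  E₂ = suc (suc e)
  E₁ = suc e
  β  = bernoulli (suc e) + δ₁ (suc e)
  K  = ℕ→ℚ (n C i) * (1/ℕ E₂ * 1/ℕ E₁)
  regroup : ∀ c c′ w u b → c * c′ * w * u * b ≡ c * u * (c′ * w * b)
  regroup = solve-∀ ℚ-ring
  regroup′ : ∀ c u v E b → c * (u * v) * (E * b) ≡ c * b * v * (E * u)
  regroup′ = solve-∀ ℚ-ring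

-- The second term on the right is Σ_{i ≤ n+1} G i * S i, where G i = B_i m^{n+2-i}/m² (i may be
-- n+1) and S i = Σ_j κ n j i B_j.
module RightHandSide (m : ℕ) .{{_ : NonZero m}} (n : ℕ) where

  M μ : ℚ
  M = ℕ→ℚ m
  μ = 1/ℕ m

  N : ℕ
  N = suc (suc n)

  c : ℕ → ℚ
  c j = ℕ→ℚ (n C j) * bernoulli j

  rhs-as-powerSums : + (m ℕ.^ n) / m * sumBelow m (λ k → + k / m * bernoulliPoly n (+ k / m)) ≡
    sumBelow (suc n) (λ j → c j * (M ^ℚ j * (μ * μ)) * powerSum (suc (n ∸ j)) m)
  rhs-as-powerSums = begin
    + (m ℕ.^ n) / m * sumBelow m (λ k → + k / m * bernoulliPoly n (+ k / m))
      ≡⟨ cong₂ _*_ (trans (+a/d≡a*1/ℕd (m ℕ.^ n) m) (cong (_* μ) (ℕ→ℚ-^ m n)))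
                   (sumBelow-cong m (λ {k} _ → cong (λ x → x * bernoulliPoly n x) (+a/d≡a*1/ℕd k m))) ⟩
    M ^ℚ n * μ * sumBelow m (λ k → ℕ→ℚ k * μ * bernoulliPoly n (ℕ→ℚ k * μ))
      ≡⟨ cong (M ^ℚ n * μ *_) (sumBelow-*-bernoulliPoly m n (λ k → ℕ→ℚ k * μ)) ⟩
    M ^ℚ n * μ * sumBelow (suc n) (λ j → c j * sumBelow m (λ k → (ℕ→ℚ k * μ) ^ℚ suc (n ∸ j)))
      ≡⟨ sumBelow-*ˡ (suc n) (M ^ℚ n * μ) _ ⟩
    sumBelow (suc n) (λ j → M ^ℚ n * μ * (c j * sumBelow m (λ k → (ℕ→ℚ k * μ) ^ℚ suc (n ∸ j))))
      ≡⟨ sumBelow-cong (suc n) (rescale ∘ ℕₚ.≤-pred) ⟩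
    sumBelow (suc n) (λ j → c j * (M ^ℚ j * (μ * μ)) * powerSum (suc (n ∸ j)) m)  ∎
    where
    rescale : ∀ {j} → j ≤ n → M ^ℚ n * μ * (c j * sumBelow m (λ k → (ℕ→ℚ k * μ) ^ℚ suc (n ∸ j))) ≡
                              c j * (M ^ℚ j * (μ * μ)) * powerSum (suc (n ∸ j)) m
    rescale {j} j≤n = begin
      M ^ℚ n * μ * (c j * sumBelow m (λ k → (ℕ→ℚ k * μ) ^ℚ suc a))
        ≡⟨ cong (λ s → M ^ℚ n * μ * (c j * s))
                (trans (sumBelow-cong m (λ {k} _ → ^ℚ-distrib-* (ℕ→ℚ k) μ (suc a)))
                       (sym (sumBelow-*ʳ m (μ ^ℚ suc a) _))) ⟩
      M ^ℚ n * μ * (c j * (powerSum (suc a) m * (μ * μ ^ℚ a)))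
        ≡⟨ regroup (M ^ℚ n) μ (c j) (powerSum (suc a) m) (μ ^ℚ a) ⟩
      c j * (M ^ℚ n * μ ^ℚ a * (μ * μ)) * powerSum (suc a) m
        ≡⟨ cong (λ z → c j * (z * (μ * μ)) * powerSum (suc a) m) Mⁿμᵃ≡Mʲ ⟩
      c j * (M ^ℚ j * (μ * μ)) * powerSum (suc a) m  ∎
      where
      a = n ∸ j
      Mⁿμᵃ≡Mʲ : M ^ℚ n * μ ^ℚ a ≡ M ^ℚ j
      Mⁿμᵃ≡Mʲ = trans (cong (λ e → M ^ℚ e * μ ^ℚ a) (sym (ℕₚ.m+[n∸m]≡n j≤n)))
                      (^ℚ-cancel (ℕ→ℚ-*-1/ℕ m) j a)
      regroup : ∀ Mⁿ μ c P μᵃ → Mⁿ * μ * (c * (P * (μ * μᵃ))) ≡ c * (Mⁿ * μᵃ * (μ * μ)) * P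
      regroup = solve-∀ ℚ-ring

  F : ℕ → ℕ → ℚ
  F j i = bernoulli i * M ^ℚ (N ∸ i) * (μ * μ) * (κ n j i * bernoulli j)

  faulhaber-row : ∀ {j} → j ≤ n →
    c j * (M ^ℚ j * (μ * μ)) * powerSum (suc (n ∸ j)) m ≡ sumBelow (N ∸ j) (F j)
  faulhaber-row {j} j≤n = begin
    X * powerSum (suc (n ∸ j)) m
      ≡⟨ cong (X *_) (ℕ→ℚ*a≡b⇒a≡1/ℕ*b (suc (suc (n ∸ j))) (faulhaber (suc (n ∸ j)) m)) ⟩
    X * (1/ℕ (suc (suc (n ∸ j))) * faulhaber-sum (suc (n ∸ j)))
      ≡⟨ cong (λ q → X * (1/ℕ (suc q) * faulhaber-sum q)) (ℕₚ.+-∸-assoc 1 j≤n) ⟨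
    X * (1/ℕ Q * faulhaber-sum (suc n ∸ j))
      ≡⟨ trans (sym (*-assoc X (1/ℕ Q) _)) (sumBelow-*ˡ Q (X * 1/ℕ Q) _) ⟩
    sumBelow Q (λ i → X * 1/ℕ Q * (ℕ→ℚ (Q C i) * bernoulli i * M ^ℚ (Q ∸ i)))
      ≡⟨ sumBelow-cong Q term ⟩
    sumBelow Q (F j)
      ≡⟨ cong (λ l → sumBelow l (F j)) N∸j≡Q ⟨
    sumBelow (N ∸ j) (F j)  ∎
    where
    X = c j * (M ^ℚ j * (μ * μ))
    Q = suc (suc n ∸ j)
    faulhaber-sum : ℕ → ℚ
    faulhaber-sum q = sumBelow (suc q) (λ i → ℕ→ℚ (suc q C i) * bernoulli i * M ^ℚ (suc q ∸ i))
    N∸j≡Q : N ∸ j ≡ Q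
    N∸j≡Q = ℕₚ.+-∸-assoc 1 (ℕₚ.m≤n⇒m≤1+n j≤n)
    exponent : ∀ {i} → i < Q → j ℕ.+ (Q ∸ i) ≡ N ∸ i
    exponent {i} i<Q = begin
      j ℕ.+ (Q ∸ i)        ≡⟨ cong (λ q → j ℕ.+ (q ∸ i)) N∸j≡Q ⟨
      j ℕ.+ (N ∸ j ∸ i)    ≡⟨ ℕₚ.+-∸-assoc j (subst (i ≤_) (sym N∸j≡Q) (ℕₚ.<⇒≤ i<Q)) ⟨
      j ℕ.+ (N ∸ j) ∸ i    ≡⟨ cong (_∸ i) (ℕₚ.m+[n∸m]≡n (ℕₚ.m≤n⇒m≤1+n (ℕₚ.m≤n⇒m≤1+n j≤n))) ⟩
      N ∸ i                ∎
    term : ∀ {i} → i < Q → X * 1/ℕ Q * (ℕ→ℚ (Q C i) * bernoulli i * M ^ℚ (Q ∸ i)) ≡ F j i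
    term {i} i<Q = begin
      X * 1/ℕ Q * (ℕ→ℚ (Q C i) * bernoulli i * M ^ℚ (Q ∸ i))
        ≡⟨ regroup (ℕ→ℚ (n C j)) (bernoulli j) (M ^ℚ j) (μ * μ) (1/ℕ Q) (ℕ→ℚ (Q C i)) (bernoulli i) _ ⟩
      bernoulli i * (M ^ℚ j * M ^ℚ (Q ∸ i)) * (μ * μ) * (κ n j i * bernoulli j)
        ≡⟨ cong (λ z → bernoulli i * z * (μ * μ) * (κ n j i * bernoulli j))
                (trans (sym (^ℚ-+ M j (Q ∸ i))) (cong (M ^ℚ_) (exponent i<Q))) ⟩
      F j i  ∎
      where
      regroup : ∀ C B Mʲ μ² q C′ B′ Mᵉ →
        C * B * (Mʲ * μ²) * q * (C′ * B′ * Mᵉ) ≡ B′ * (Mʲ * Mᵉ) * μ² * (C * C′ * q * B)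
      regroup = solve-∀ ℚ-ring

  G : ℕ → ℚ
  G i = bernoulli i * M ^ℚ (N ∸ i) * (μ * μ)

  S : ℕ → ℚ
  S i = sumBelow (N ∸ i) (λ j → κ n j i * bernoulli j)

  powerSums-regrouped : sumBelow (suc n) (λ j → c j * (M ^ℚ j * (μ * μ)) * powerSum (suc (n ∸ j)) m) ≡
    sumBelow N (λ i → G i * S i)
  powerSums-regrouped = begin
    sumBelow (suc n) (λ j → c j * (M ^ℚ j * (μ * μ)) * powerSum (suc (n ∸ j)) m)
      ≡⟨ sumBelow-cong (suc n) (faulhaber-row ∘ ℕₚ.≤-pred) ⟩
    sumBelow (suc n) (λ j → sumBelow (N ∸ j) (F j))
      ≡⟨ +-identityʳ _ ⟨
    sumBelow (suc n) (λ j → sumBelow (N ∸ j) (F j)) + 0ℚ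
      ≡⟨ cong (_+_ (sumBelow (suc n) (λ j → sumBelow (N ∸ j) (F j)))) last-row-vanishes ⟨
    sumBelow N (λ j → sumBelow (N ∸ j) (F j))
      ≡⟨ sumBelow-triangle N F ⟩
    sumBelow N (λ i → sumBelow (N ∸ i) (λ j → F j i))
      ≡⟨ sumBelow-cong N (λ {i} _ → sumBelow-*ˡ (N ∸ i) (G i) _) ⟨
    sumBelow N (λ i → G i * S i)  ∎
    where
    last-row-vanishes : sumBelow (N ∸ suc n) (F (suc n)) ≡ 0ℚ
    last-row-vanishes = trans (sumBelow-cong (N ∸ suc n) (λ {i} _ → vanishes i)) (sumBelow-0 (N ∸ suc n))
      where
      vanishes : ∀ i → F (suc n) i ≡ 0ℚ
      vanishes i = begin
        G i * (κ n (suc n) i * bernoulli (suc n))  ≡⟨ cong (λ x → G i * (x * bernoulli (suc n))) κ≡0 ⟩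
        G i * (0ℚ * bernoulli (suc n))             ≡⟨ cong (G i *_) (*-zeroˡ (bernoulli (suc n))) ⟩
        G i * 0ℚ                                   ≡⟨ *-zeroʳ (G i) ⟩
        0ℚ                                         ∎
        where
        Q = suc (suc n ∸ suc n)
        κ≡0 : κ n (suc n) i ≡ 0ℚ
        κ≡0 = begin
          ℕ→ℚ (n C suc n) * ℕ→ℚ (Q C i) * 1/ℕ Q
            ≡⟨ cong (λ x → ℕ→ℚ x * ℕ→ℚ (Q C i) * 1/ℕ Q) (k>n⇒nCk≡0 (ℕₚ.n<1+n n)) ⟩
          0ℚ * ℕ→ℚ (Q C i) * 1/ℕ Q
            ≡⟨ trans (cong (_* 1/ℕ Q) (*-zeroˡ (ℕ→ℚ (Q C i)))) (*-zeroˡ (1/ℕ Q)) ⟩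
          0ℚ  ∎

  S-below : ∀ {i} → i ≤ n →
    S i ≡ ℕ→ℚ (n C i) * (bernoulli (suc (n ∸ i)) + δ₁ (suc (n ∸ i))) * 1/ℕ (suc (n ∸ i))
  S-below {i} i≤n = begin
    S i
      ≡⟨ cong (λ l → sumBelow l (λ j → κ n j i * bernoulli j)) (ℕₚ.+-∸-assoc 2 i≤n) ⟩
    sumBelow (suc (suc e)) (λ j → κ n j i * bernoulli j)
      ≡⟨ subst P (ℕₚ.m+[n∸m]≡n i≤n) (sumBelow-κ*bernoulli i e) ⟩
    ℕ→ℚ (n C i) * (bernoulli (suc e) + δ₁ (suc e)) * 1/ℕ (suc e)  ∎
    where
    e = n ∸ i
    P : ℕ → Set
    P n′ = sumBelow (suc (suc e)) (λ j → κ n′ j i * bernoulli j) ≡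
           ℕ→ℚ (n′ C i) * (bernoulli (suc e) + δ₁ (suc e)) * 1/ℕ (suc e)

  S-top : S (suc n) ≡ 1ℚ
  S-top = begin
    S (suc n)
      ≡⟨ cong (λ l → sumBelow l (λ j → κ n j (suc n) * bernoulli j)) (ℕₚ.m+n∸n≡m 1 n) ⟩
    0ℚ + 1ℚ * ℕ→ℚ (N C suc n) * 1/ℕ N * 1ℚ
      ≡⟨ cong (λ x → 0ℚ + 1ℚ * ℕ→ℚ x * 1/ℕ N * 1ℚ) ([1+n]Cn≡1+n (suc n)) ⟩
    0ℚ + 1ℚ * ℕ→ℚ N * 1/ℕ N * 1ℚ
      ≡⟨ simplify (ℕ→ℚ N) (1/ℕ N) ⟩
    ℕ→ℚ N * 1/ℕ N
      ≡⟨ ℕ→ℚ-*-1/ℕ N ⟩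
    1ℚ  ∎
    where
    simplify : ∀ x y → 0ℚ + 1ℚ * x * y * 1ℚ ≡ x * y
    simplify = solve-∀ ℚ-ring

  L : ℕ → ℚ
  L k = ℕ→ℚ (n C k) * ℕ→ℚ (m ℕ.^ k) * bernoulli (suc k) * bernoulli (n ∸ k) * (+ 1 / suc k)

  D : ℕ → ℚ
  D i = bernoulli i * M ^ℚ (n ∸ i) * ℕ→ℚ (n C i) * 1/ℕ (suc (n ∸ i)) * δ₁ (suc (n ∸ i))

  G*S-below : ∀ {i} → i ≤ n → G i * S i ≡ L (n ∸ i) + D i
  G*S-below {i} i≤n = begin
    bernoulli i * M ^ℚ (N ∸ i) * (μ * μ) * S i
      ≡⟨ cong₂ (λ e s → bernoulli i * M ^ℚ e * (μ * μ) * s) (ℕₚ.+-∸-assoc 2 i≤n) (S-below i≤n) ⟩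
    bernoulli i * M ^ℚ suc (suc a) * (μ * μ) * (ℕ→ℚ (n C i) * (bernoulli (suc a) + δ₁ (suc a)) * 1/ℕ (suc a))
      ≡⟨ cong (_* (ℕ→ℚ (n C i) * (bernoulli (suc a) + δ₁ (suc a)) * 1/ℕ (suc a)))
              (trans (*-assoc (bernoulli i) _ _) (cong (bernoulli i *_) Mᵃ⁺²μ²≡Mᵃ)) ⟩
    bernoulli i * M ^ℚ a * (ℕ→ℚ (n C i) * (bernoulli (suc a) + δ₁ (suc a)) * 1/ℕ (suc a))
      ≡⟨ expand (bernoulli i) (M ^ℚ a) (ℕ→ℚ (n C i)) (bernoulli (suc a)) (δ₁ (suc a)) (1/ℕ (suc a)) ⟩
    ℕ→ℚ (n C i) * M ^ℚ a * bernoulli (suc a) * bernoulli i * 1/ℕ (suc a) + D i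
      ≡⟨ cong (_+ D i) L[n∸i] ⟨
    L a + D i  ∎
    where
    a = n ∸ i
    Mᵃ⁺²μ²≡Mᵃ : M ^ℚ suc (suc a) * (μ * μ) ≡ M ^ℚ a
    Mᵃ⁺²μ²≡Mᵃ = trans (cong₂ (λ e y → M ^ℚ e * (μ * y)) (ℕₚ.+-comm 2 a) (sym (*-identityʳ μ)))
                      (^ℚ-cancel (ℕ→ℚ-*-1/ℕ m) a 2)
    expand : ∀ b Mᵃ c B′ δ v → b * Mᵃ * (c * (B′ + δ) * v) ≡ c * Mᵃ * B′ * b * v + b * Mᵃ * c * v * δ
    expand = solve-∀ ℚ-ring
    L[n∸i] : L a ≡ ℕ→ℚ (n C i) * M ^ℚ a * bernoulli (suc a) * bernoulli i * 1/ℕ (suc a)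
    L[n∸i] = cong₂ (λ x y → x * bernoulli (suc a) * bernoulli y * 1/ℕ (suc a))
                   (cong₂ _*_ (cong ℕ→ℚ (sym (nCk≡nC[n∸k] i≤n))) (ℕ→ℚ-^ m a)) (ℕₚ.m∸[m∸n]≡n i≤n)

  sumBelow-D : sumBelow (suc n) D ≡ bernoulli n
  sumBelow-D = begin
    sumBelow n D + D n
      ≡⟨ cong₂ _+_ (trans (sumBelow-cong n below) (sumBelow-0 n))
                   (cong (λ a → bernoulli n * M ^ℚ a * ℕ→ℚ (n C n) * 1/ℕ (suc a) * δ₁ (suc a)) (ℕₚ.n∸n≡0 n)) ⟩
    0ℚ + bernoulli n * 1ℚ * ℕ→ℚ (n C n) * 1ℚ * 1ℚ
      ≡⟨ cong (λ x → 0ℚ + bernoulli n * 1ℚ * ℕ→ℚ x * 1ℚ * 1ℚ) (nCn≡1 n) ⟩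
    0ℚ + bernoulli n * 1ℚ * 1ℚ * 1ℚ * 1ℚ
      ≡⟨ simplify (bernoulli n) ⟩
    bernoulli n  ∎
    where
    below : ∀ {i} → i < n → D i ≡ 0ℚ
    below {i} i<n = trans (cong (λ a → d * δ₁ (suc a)) (ℕₚ.+-∸-assoc 1 i<n)) (*-zeroʳ d)
      where d = bernoulli i * M ^ℚ (n ∸ i) * ℕ→ℚ (n C i) * 1/ℕ (suc (n ∸ i))
    simplify : ∀ b → 0ℚ + b * 1ℚ * 1ℚ * 1ℚ * 1ℚ ≡ b
    simplify = solve-∀ ℚ-ring

  G*S-top : G (suc n) * S (suc n) ≡ bernoulli (suc n) * μ
  G*S-top = begin
    G (suc n) * S (suc n)
      ≡⟨ trans (cong (G (suc n) *_) S-top) (*-identityʳ (G (suc n))) ⟩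
    bernoulli (suc n) * M ^ℚ (N ∸ suc n) * (μ * μ)
      ≡⟨ cong (λ e → bernoulli (suc n) * M ^ℚ e * (μ * μ)) (ℕₚ.m+n∸n≡m 1 n) ⟩
    bernoulli (suc n) * (M * 1ℚ) * (μ * μ)
      ≡⟨ regroup (bernoulli (suc n)) M μ ⟩
    bernoulli (suc n) * μ * (M * μ)
      ≡⟨ trans (cong (bernoulli (suc n) * μ *_) (ℕ→ℚ-*-1/ℕ m)) (*-identityʳ _) ⟩
    bernoulli (suc n) * μ  ∎
    where
    regroup : ∀ b M μ → b * (M * 1ℚ) * (μ * μ) ≡ b * μ * (M * μ)
    regroup = solve-∀ ℚ-ring

  rhs-expanded : + (m ℕ.^ n) / m * sumBelow m (λ k → + k / m * bernoulliPoly n (+ k / m)) ≡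
    sumBelow (suc n) L + bernoulli n + bernoulli (suc n) * μ
  rhs-expanded = begin
    + (m ℕ.^ n) / m * sumBelow m (λ k → + k / m * bernoulliPoly n (+ k / m))
      ≡⟨ trans rhs-as-powerSums powerSums-regrouped ⟩
    sumBelow (suc n) (λ i → G i * S i) + G (suc n) * S (suc n)
      ≡⟨ cong₂ _+_ (sumBelow-cong (suc n) (G*S-below ∘ ℕₚ.≤-pred)) G*S-top ⟩
    sumBelow (suc n) (λ i → L (n ∸ i) + D i) + bernoulli (suc n) * μ
      ≡⟨ cong (_+ bernoulli (suc n) * μ)
              (trans (sumBelow-+ (suc n) _ D) (cong₂ _+_ (sym (sumBelow-reverse n L)) sumBelow-D)) ⟩
    sumBelow (suc n) L + bernoulli n + bernoulli (suc n) * μ  ∎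

corollary1 : (m : ℕ) → .{{_ : NonZero m}} → (n : ℕ) →
    sumBelow (suc n)
      (λ k → ℕ→ℚ (n C k) * ℕ→ℚ (m ℕ.^ k) * bernoulli (suc k) * bernoulli (n ℕ.∸ k)
             * ((+ 1) / suc k))
    ≡
    ((- (ℕ→ℚ m * bernoulli n)) - bernoulli (suc n)) * ((+ 1) / m)
    + ((+ (m ℕ.^ n)) / m)
      * sumBelow m (λ k → ((+ k) / m) * bernoulliPoly n ((+ k) / m))
corollary1 m n = begin
  lhs
    ≡⟨ cancel lhs (bernoulli n) (bernoulli (suc n)) (ℕ→ℚ m) (1/ℕ m) (ℕ→ℚ-*-1/ℕ m) ⟨
  ((- (ℕ→ℚ m * bernoulli n)) - bernoulli (suc n)) * 1/ℕ m + (lhs + bernoulli n + bernoulli (suc n) * 1/ℕ m)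
    ≡⟨ cong (_+_ (((- (ℕ→ℚ m * bernoulli n)) - bernoulli (suc n)) * 1/ℕ m)) rhs-expanded ⟨
  ((- (ℕ→ℚ m * bernoulli n)) - bernoulli (suc n)) * 1/ℕ m
    + + (m ℕ.^ n) / m * sumBelow m (λ k → + k / m * bernoulliPoly n (+ k / m))  ∎
  where
  open RightHandSide m n using (L; rhs-expanded)
  lhs = sumBelow (suc n) L
  cancel : ∀ l b b′ M μ → M * μ ≡ 1ℚ → ((- (M * b)) - b′) * μ + (l + b + b′ * μ) ≡ l
  cancel l b b′ M μ Mμ≡1 =
    trans (expand l b b′ M μ) (trans (cong (λ x → l + b * (1ℚ - x)) Mμ≡1) (collapse l b))
    where
    expand : ∀ l b b′ M μ → ((- (M * b)) - b′) * μ + (l + b + b′ * μ) ≡ l + b * (1ℚ - M * μ)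
    expand = solve-∀ ℚ-ring
    collapse : ∀ l b → l + b * (1ℚ - 1ℚ) ≡ l
    collapse = solve-∀ ℚ-ring
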